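{- Let $(D,\sqsubseteq,\oplus,\mathcal B)$ be an interpretation monoid whose basis is the irreducible basis $\mathcal B=\mathrm{Ir}(D)\cup\{\bot\}$, with basis semantics for elementary commands as described in the context. Assume that the full semantics $[\![r]\!]:D\to D$ is additive for every regular command $r$ and that $\oplus$ preserves additivity. Then for all $d\in D$ and all regular commands $e$ (elementary), $r_1,r_2,r$: $[\![e]\!]d=\bigsqcup_{b\in\mathcal B_d}[\![e]\!]_{\mathcal B}b$, $[\![r_1;r_2]\!]d=[\![r_2]\!]([\![r_1]\!]d)$, $[\![r_1+r_2]\!]d=[\![r_1]\!]d\oplus[\![r_2]\!]d$, and $[\![r^*]\!]d=\big(\bigoplus_{i\ge0}[\![r^i]\!]\big)(d)$.
   Context: Let $(D,\sqsubseteq)$ be a complete lattice with join $\sqcup$, bottom $\bot$. A (join) basis is $\mathcal B\subseteq D$ with $d=\bigsqcup\mathcal B_d$ for all $d$, where $\mathcal B_d=\{b\in\mathcal B\mid b\sqsubseteq d\}$; pointed if $\bot\in\mathcal B$. An element $d$ is completely join-irreducible if $d=\bigsqcup X$ implies $d\in X$ for every $X\subseteq D$; $\mathrm{Ir}(D)$ is the set of these, and the irreducible basis is $\mathrm{Ir}(D)\cup\{\bot\}$ (assumed to be a basis). For $X\subseteq D$, $\downarrow X=\{d\mid\exists x\in X.\ d\sqsubseteq x\}$; weight $w(d)=\min\{|Y|:Y\subseteq\mathcal B_d,\downarrow Y=\downarrow\mathcal B_d\}$, $w(X)=\sup_{d\in X}w(d)$. A complete monoid $(M,\oplus)$ assigns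 to every family $(m_i)_{i\in I}$ ($I$ arbitrary) an element $\bigoplus_{i\in I}m_i$ with $\bigoplus_{i\in\{j\}}m_i=m_j$ and $\bigoplus_{i\in I}m_i=\bigoplus_{j\in J}\bigoplus_{i\in I_j}m_i$ for every partition $(I_j)_{j\in J}$ of $I$; $0_\oplus$ is the empty sum. $\langle S\rangle$ is the least complete submonoid containing $S$. An ordered complete monoid is a complete monoid with a partial order for which $\oplus$ is monotone. For a cardinal $\kappa$, a $\kappa$-quantale is an ordered complete monoid in which every subset of cardinality $\le\kappa$ has a join and $\bigoplus_{i\in I}\bigsqcup_{j\in J_i}x_{i,j}=\bigsqcup_{\beta}\bigoplus_{i\in I}x_{i,\beta(i)}$ for all index sets $I$ and nonempty $J_i$ with $|J_i|\le\kappa$ ($\beta(i)\in J_i$; right-hand join required to exist). An interpretation monoid $(D,\sqsubseteq,\oplus,\mathcal B)$: $(D,\sqsubseteq,\oplus)$ ordered complete monoid, $(D,\sqsubseteq)$ complete lattice, $\mathcal B$ pointed basis, $\langle\mathcal B\rangle$ a $\kappa_D$-quantale with $\kappa_D=w(\langle\mathcal B\rangle)$. Commands and semantics. $r::=e\mid r;r\mid r+r\mid r^*$ over elementary commands including $\mathsf0,\mathsf1$; $r^0=\mathsf1$, $r^{i+1}=r;r^i$. For $f:\mathcal B\to D$, $f^+(d)=\bigsqcup_{b\in\mathcal B_d}f(b)$. Each elementary $e$ has a monotone $[\![e]\!]_{\mathcal B}:\mathcal B\to\langle\mathcal B\rangle$ with $[\![\mathsf0]\!]_{\mathcal B}b=0_\oplus$,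 $[\![\mathsf1]\!]_{\mathcal B}b=b$; $[\![r_1;r_2]\!]_{\mathcal B}b=([\![r_2]\!]_{\mathcal B})^+([\![r_1]\!]_{\mathcal B}b)$, $[\![r_1+r_2]\!]_{\mathcal B}b=[\![r_1]\!]_{\mathcal B}b\oplus[\![r_2]\!]_{\mathcal B}b$, $[\![r^*]\!]_{\mathcal B}b=\bigoplus_{i\ge0}[\![r^i]\!]_{\mathcal B}b$; full semantics $[\![r]\!]=([\![r]\!]_{\mathcal B})^+$. A function $f:D\to D$ is additive if $f(\bigsqcup X)=\bigsqcup_{x\in X}f(x)$ for all $X\subseteq D$. For $f_i:D\to D$, the pointwise combination is $(\bigoplus_{i\in I}f_i)(d)=\bigoplus_{i\in I}f_i(d)$; $\oplus$ preserves additivity if $\bigoplus_{i\in I}f_i$ is additive whenever every $f_i$ is additive. -}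

module Defs where

open import Level using (Level) renaming (zero to lzero)
open import Data.Nat using (ℕ; zero; suc)
open import Data.Bool using (Bool; if_then_else_)
open import Data.Empty using (⊥; ⊥-elim)
open import Data.Product using (Σ; ∃; _×_; _,_)
open import Data.Sum using (_⊎_)
open import Function using (_∘_; _⇔_)
open import Function.Definitions using (Injective)
open import Relation.Binary.PropositionalEquality using (_≡_)

-- Ordered complete monoid whose order is a complete lattice.
-- Index sets / subsets are rendered as families indexed by types in Set.

record CLMonoid : Set₁ where
  field
    D        : Set
    _⊑_      : D → D → Set
    ⊑-refl   : ∀ {x} → x ⊑ x
    ⊑-trans  : ∀ {x y z} → x ⊑ y → y ⊑ z → x ⊑ z
    ⊑-antisym : ∀ {x y} → x ⊑ y → y ⊑ x → x ≡ y
    ⨆        : (I : Set) → (I → D) → D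
    ⨆-upper  : ∀ (I : Set) (f : I → D) (i : I) → f i ⊑ ⨆ I f
    ⨆-least  : ∀ (I : Set) (f : I → D) (u : D) → (∀ i → f i ⊑ u) → ⨆ I f ⊑ u
    ⨁        : (I : Set) → (I → D) → D
    ⨁-single : ∀ (I : Set) (m : I → D) (j : I) → (∀ i → i ≡ j) → ⨁ I m ≡ m j
    -- generalised associativity for every partition of I, the blocks being
    -- the fibres of a map p : I → J
    ⨁-part   : ∀ (I J : Set) (p : I → J) (m : I → D) →
               ⨁ I m ≡ ⨁ J (λ j → ⨁ (Σ I (λ i → p i ≡ j)) (λ x → m (Data.Product.proj₁ x)))
    ⨁-mono   : ∀ (I : Set) (m n : I → D) → (∀ i → m i ⊑ n i) → ⨁ I m ⊑ ⨁ I n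

module Theory (M : CLMonoid) where
  open CLMonoid M public

  ⊥D : D
  ⊥D = ⨆ ⊥ ⊥-elim

  0⊕ : D
  0⊕ = ⨁ ⊥ ⊥-elim

  _⊕_ : D → D → D
  x ⊕ y = ⨁ Bool (λ t → if t then x else y)

  Ir : D → Set₁
  Ir d = ∀ (I : Set) (f : I → D) → d ≡ ⨆ I f → ∃ λ i → f i ≡ d

  IrB : D → Set₁
  IrB d = Ir d ⊎ d ≡ ⊥D

  -- B_d as an index type (in Set₁ because IrB is)
  -- NB: ⨆ is indexed by Set, so B_d is described by a predicate in Set;
  -- we therefore work with a general predicate B : D → Set below and
  -- relate it to IrB by a hypothesis.

  module Basis (B : D → Set) where

    Bd : D → Set
    Bd d = Σ D (λ b → B b × b ⊑ d)

    IsBasis : Set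
    IsBasis = ∀ d → d ≡ ⨆ (Bd d) (Data.Product.proj₁)

    _⁺ : (D → D) → D → D
    (f ⁺) d = ⨆ (Bd d) (λ x → f (Data.Product.proj₁ x))

    -- ⟨B⟩ : least complete submonoid containing B
    InSub : D → Set₁
    InSub d = ∀ (P : D → Set) → (∀ x → B x → P x) →
              (∀ (I : Set) (f : I → D) → (∀ i → P (f i)) → P (⨁ I f)) → P d

    ↓ : (D → Set) → D → Set
    ↓ X x = ∃ λ y → X y × x ⊑ y

    Inj : Set → Set → Set
    Inj A L = Σ (A → L) (Injective _≡_ _≡_)

    -- w(d) ≤ |L| for all d ∈ ⟨B⟩, i.e. w(⟨B⟩) ≤ |L|
    WeightBoundedBy : Set → Set₁
    WeightBoundedBy L = ∀ d → InSub d →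
      Σ (D → Set) λ Y → (∀ y → Y y → B y × y ⊑ d)
                      × (∀ x → ↓ Y x ⇔ ↓ (λ b → B b × b ⊑ d) x)
                      × Inj (Σ D Y) L

    -- |J| ≤ κ_D = w(⟨B⟩) (the supremum is the least upper bound)
    CardLeκ : Set → Set₁
    CardLeκ J = ∀ (L : Set) → WeightBoundedBy L → Inj J L

    IsJoinIn : D → (I : Set) → (I → D) → Set₁
    IsJoinIn x I f = InSub x × (∀ i → f i ⊑ x)
                   × (∀ u → InSub u → (∀ i → f i ⊑ u) → x ⊑ u)

    IsκQuantale : Set₁
    IsκQuantale =
      (∀ (J : Set) (f : J → D) → CardLeκ J → (∀ j → InSub (f j)) →
         Σ D λ x → IsJoinIn x J f)
      × (∀ (I : Set) (J : I → Set) → (∀ i → J i) → (∀ i → CardLeκ (J i)) →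
         (x : (i : I) → J i → D) → (∀ i j → InSub (x i j)) →
         (l : I → D) → (∀ i → IsJoinIn (l i) (J i) (x i)) →
         IsJoinIn (⨁ I l) ((i : I) → J i) (λ β → ⨁ I (λ i → x i (β i))))

    Additive : (D → D) → Set₁
    Additive h = ∀ (I : Set) (f : I → D) → h (⨆ I f) ≡ ⨆ I (h ∘ f)

    ⊕PreservesAdditivity : Set₁
    ⊕PreservesAdditivity = ∀ (I : Set) (fs : I → D → D) →
      (∀ i → Additive (fs i)) → Additive (λ d → ⨁ I (λ i → fs i d))

    data Cmd (E : Set) : Set where
      elem : E → Cmd E
      _⨟_  : Cmd E → Cmd E → Cmd E
      _+ᶜ_ : Cmd E → Cmd E → Cmd E
      _*   : Cmd E → Cmd E

    module Sem (E : Set) (𝟙 : E) (ev : E → D → D) where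

      pow : Cmd E → ℕ → Cmd E
      pow r zero    = elem 𝟙
      pow r (suc i) = r ⨟ pow r i

      -- basis semantics ⟦r⟧_B (only meaningful on basis elements)
      semB   : Cmd E → D → D
      -- semPow r i = ⟦r^i⟧_B, unfolded so that recursion is structural
      semPow : Cmd E → ℕ → D → D
      semB (elem e)   b = ev e b
      semB (r₁ ⨟ r₂)  b = (semB r₂ ⁺) (semB r₁ b)
      semB (r₁ +ᶜ r₂) b = semB r₁ b ⊕ semB r₂ b
      semB (r *)      b = ⨁ ℕ (λ i → semPow r i b)
      semPow r zero    b = ev 𝟙 b
      semPow r (suc i) b = (semPow r i ⁺) (semB r b)

      ⟦_⟧ : Cmd E → D → D
      ⟦ r ⟧ = semB r ⁺

{-# OPTIONS --safe #-}
module Submission where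

open import Defs
open import Data.Bool using (Bool; true; false; if_then_else_)
open import Data.Nat using (ℕ; zero; suc)
open import Data.Product using (_×_; _,_; proj₁)
open import Function using (_∘_)
open import Relation.Binary.PropositionalEquality
  using (_≡_; refl; sym; cong; cong₂; module ≡-Reasoning)

-- Since semB r is monotone on the basis, its extension ⟦ r ⟧ = (semB r)⁺ agrees with it on
-- the basis.  An additive map h coincides with h⁺, so two additive maps that agree on the
-- basis are equal.  ⊕PreservesAdditivity makes ⟦ r₁ ⟧ ⊕ ⟦ r₂ ⟧ and ⨁ᵢ ⟦ rⁱ ⟧ additive, and on
-- the basis they agree with ⟦ r₁ +ᶜ r₂ ⟧ and ⟦ r * ⟧; sequencing is additivity of ⟦ r₂ ⟧.

module _ (M : CLMonoid) where
  open Theory M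

  ⊑-reflexive : ∀ {x y} → x ≡ y → x ⊑ y
  ⊑-reflexive refl = ⊑-refl

  ⨆-cong : ∀ (I : Set) {f g : I → D} → (∀ i → f i ≡ g i) → ⨆ I f ≡ ⨆ I g
  ⨆-cong I {f} {g} f≡g = ⊑-antisym
    (⨆-least I f _ (λ i → ⊑-trans (⊑-reflexive (f≡g i)) (⨆-upper I g i)))
    (⨆-least I g _ (λ i → ⊑-trans (⊑-reflexive (sym (f≡g i))) (⨆-upper I f i)))

  ⨁-cong : ∀ (I : Set) {f g : I → D} → (∀ i → f i ≡ g i) → ⨁ I f ≡ ⨁ I g
  ⨁-cong I {f} {g} f≡g = ⊑-antisym
    (⨁-mono I f g (λ i → ⊑-reflexive (f≡g i)))
    (⨁-mono I g f (λ i → ⊑-reflexive (sym (f≡g i))))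

  module _ (B : D → Set) where
    open Basis B

    ⁺-mono : ∀ (f : D → D) {x y} → x ⊑ y → (f ⁺) x ⊑ (f ⁺) y
    ⁺-mono f {x} {y} x⊑y = ⨆-least (Bd x) _ _
      (λ { (b , Bb , b⊑x) → ⨆-upper (Bd y) (f ∘ proj₁) (b , Bb , ⊑-trans b⊑x x⊑y) })

    ⁺-cong : ∀ {f g : D → D} → (∀ b → B b → f b ≡ g b) → ∀ d → (f ⁺) d ≡ (g ⁺) d
    ⁺-cong f≡g d = ⨆-cong (Bd d) (λ { (b , Bb , _) → f≡g b Bb })

    MonotoneOnBasis : (D → D) → Set
    MonotoneOnBasis f = ∀ {b b′} → B b → B b′ → b ⊑ b′ → f b ⊑ f b′

    ⁺-extends : ∀ {f : D → D} → MonotoneOnBasis f → ∀ b → B b → (f ⁺) b ≡ f b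
    ⁺-extends {f} f-mono b Bb = ⊑-antisym
      (⨆-least (Bd b) _ _ (λ { (c , Bc , c⊑b) → f-mono Bc Bb c⊑b }))
      (⨆-upper (Bd b) (f ∘ proj₁) (b , Bb , ⊑-refl))

    additive⇒≡⁺ : IsBasis → ∀ {h : D → D} → Additive h → ∀ d → h d ≡ (h ⁺) d
    additive⇒≡⁺ isBasis {h} h-add d = begin
      h d                    ≡⟨ cong h (isBasis d) ⟩
      h (⨆ (Bd d) proj₁)     ≡⟨ h-add (Bd d) proj₁ ⟩
      ⨆ (Bd d) (h ∘ proj₁)   ∎
      where open ≡-Reasoning

    ⁺-≡-pointwise-⨁ : IsBasis → ⊕PreservesAdditivity →
      ∀ (I : Set) (fs : I → D → D) → (∀ i → Additive (fs i)) →
      ∀ {g : D → D} → (∀ b → B b → g b ≡ ⨁ I (λ i → fs i b)) →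
      ∀ d → (g ⁺) d ≡ ⨁ I (λ i → fs i d)
    ⁺-≡-pointwise-⨁ isBasis ⊕-additive I fs fs-add {g} g≡⨁ d = begin
      (g ⁺) d      ≡⟨ ⁺-cong g≡⨁ d ⟩
      (⨁fs ⁺) d    ≡⟨ sym (additive⇒≡⁺ isBasis (⊕-additive I fs fs-add) d) ⟩
      ⨁fs d        ∎
      where
        open ≡-Reasoning
        ⨁fs : D → D
        ⨁fs x = ⨁ I (λ i → fs i x)

    module _ (E : Set) (𝟙 : E) (ev : E → D → D) where
      open Sem E 𝟙 ev

      module _ (ev-mono : ∀ e → MonotoneOnBasis (ev e)) where
        semB-mono   : ∀ r → MonotoneOnBasis (semB r)
        semPow-mono : ∀ r i → MonotoneOnBasis (semPow r i)
        semB-mono (elem e)   Bb Bb′ b⊑b′ = ev-mono e Bb Bb′ b⊑b′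
        semB-mono (r₁ ⨟ r₂)  Bb Bb′ b⊑b′ = ⁺-mono (semB r₂) (semB-mono r₁ Bb Bb′ b⊑b′)
        semB-mono (r₁ +ᶜ r₂) Bb Bb′ b⊑b′ = ⨁-mono Bool _ _
          (λ { true → semB-mono r₁ Bb Bb′ b⊑b′ ; false → semB-mono r₂ Bb Bb′ b⊑b′ })
        semB-mono (r *)      Bb Bb′ b⊑b′ = ⨁-mono ℕ _ _ (λ i → semPow-mono r i Bb Bb′ b⊑b′)
        semPow-mono r zero    Bb Bb′ b⊑b′ = ev-mono 𝟙 Bb Bb′ b⊑b′
        semPow-mono r (suc i) Bb Bb′ b⊑b′ = ⁺-mono (semPow r i) (semB-mono r Bb Bb′ b⊑b′)

        ⟦⟧-on-basis : ∀ r b → B b → ⟦ r ⟧ b ≡ semB r b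
        ⟦⟧-on-basis r = ⁺-extends (semB-mono r)

      semB-pow : ∀ r i b → B b → semB (pow r i) b ≡ semPow r i b
      semB-pow r zero    b Bb = refl
      semB-pow r (suc i) b Bb = ⁺-cong (semB-pow r i) (semB r b)

proposition2p17 : (M : CLMonoid) → let open Theory M in
    (B : D → Set) → let open Basis B in
    (∀ d → (B d → IrB d) × (IrB d → B d)) →
    IsBasis →
    IsκQuantale →
    (E : Set) (𝟘 𝟙 : E) (ev : E → D → D) →
    (∀ e b → B b → InSub (ev e b)) →
    (∀ e b b′ → B b → B b′ → b ⊑ b′ → ev e b ⊑ ev e b′) →
    (∀ b → B b → ev 𝟘 b ≡ 0⊕) →
    (∀ b → B b → ev 𝟙 b ≡ b) →
    let open Sem E 𝟙 ev in
    (∀ r → Additive ⟦ r ⟧) →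
    ⊕PreservesAdditivity →
    ∀ (d : D) →
      (∀ e → ⟦ elem e ⟧ d ≡ ⨆ (Bd d) (λ x → semB (elem e) (proj₁ x)))
      × (∀ r₁ r₂ → ⟦ r₁ ⨟ r₂ ⟧ d ≡ ⟦ r₂ ⟧ (⟦ r₁ ⟧ d))
      × (∀ r₁ r₂ → ⟦ r₁ +ᶜ r₂ ⟧ d ≡ ⟦ r₁ ⟧ d ⊕ ⟦ r₂ ⟧ d)
      × (∀ r → ⟦ r * ⟧ d ≡ ⨁ ℕ (λ i → ⟦ pow r i ⟧ d))
proposition2p17 M B _ isBasis _ E _ 𝟙 ev _ ev-mono _ _ ⟦⟧-additive ⊕-additive d =
  (λ e → refl) , sequence , choice , star
  where
    open Theory M
    open Basis B
    open Sem E 𝟙 ev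

    on-basis : ∀ r b → B b → ⟦ r ⟧ b ≡ semB r b
    on-basis = ⟦⟧-on-basis M B E 𝟙 ev (λ e → ev-mono e _ _)

    sequence : ∀ r₁ r₂ → ⟦ r₁ ⨟ r₂ ⟧ d ≡ ⟦ r₂ ⟧ (⟦ r₁ ⟧ d)
    sequence r₁ r₂ = sym (⟦⟧-additive r₂ (Bd d) (semB r₁ ∘ proj₁))

    choice : ∀ r₁ r₂ → ⟦ r₁ +ᶜ r₂ ⟧ d ≡ ⟦ r₁ ⟧ d ⊕ ⟦ r₂ ⟧ d
    choice r₁ r₂ =
      ⁺-≡-pointwise-⨁ M B isBasis ⊕-additive Bool (λ t x → if t then ⟦ r₁ ⟧ x else ⟦ r₂ ⟧ x)
        (λ { true → ⟦⟧-additive r₁ ; false → ⟦⟧-additive r₂ })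
        (λ b Bb → sym (cong₂ _⊕_ (on-basis r₁ b Bb) (on-basis r₂ b Bb))) d

    star : ∀ r → ⟦ r * ⟧ d ≡ ⨁ ℕ (λ i → ⟦ pow r i ⟧ d)
    star r =
      ⁺-≡-pointwise-⨁ M B isBasis ⊕-additive ℕ (λ i → ⟦ pow r i ⟧) (λ i → ⟦⟧-additive (pow r i))
        (λ b Bb → ⨁-cong M ℕ (λ i → begin
          semPow r i b      ≡⟨ semB-pow M B E 𝟙 ev r i b Bb ⟨
          semB (pow r i) b  ≡⟨ on-basis (pow r i) b Bb ⟨
          ⟦ pow r i ⟧ b     ∎)) d
      where open ≡-Reasoning
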